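{- Let $(X,\leq,g)$ be a Kleene--Varlet space such that $(X,\leq)$ is a union of disjoint chains of at most two elements. Then for every upward-closed subset $A$ of $(X,\leq)$, \[A^*=(A\cup g[A])^c,\] where $A^*=\{x\in X\mid {\uparrow}x\cap A=\emptyset\}$, ${\uparrow}x=\{y\mid x\leq y\}$, $g[A]=\{g(a)\mid a\in A\}$ and ${}^c$ denotes complement in $X$.
   Context: A Kleene--Varlet space is a triple $(X,\leq,g)$ where $(X,\leq)$ is a poset and $g\colon X\to X$ satisfies: (J1) $x\leq y$ implies $g(x)\geq g(y)$; (J2) $g(g(x))=x$; (J3) $x\leq g(x)$ or $g(x)\leq x$; (J4) every chain in $(X,\leq)$ has at most two elements. "Union of disjoint chains of at most two elements" means $X$ can be partitioned into chains of at most two elements such that elements of different blocks are incomparable. -}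

module Defs where

open import Level using (Level; _⊔_; suc)
open import Data.Product using (Σ; ∃; _×_; _,_)
open import Data.Sum using (_⊎_)
open import Relation.Nullary using (¬_)
open import Relation.Binary.Bundles using (Poset)
open import Relation.Unary using (Pred; _∈_; _∩_; _∪_; ∁; Empty; _≐_)

module _ {c ℓ₁ ℓ₂ : Level} (P : Poset c ℓ₁ ℓ₂) where
  open Poset P renaming (Carrier to X)

  Comparable : X → X → Set ℓ₂
  Comparable x y = (x ≤ y) ⊎ (y ≤ x)

  ChainsAtMostTwo : Set (c ⊔ ℓ₁ ⊔ ℓ₂)
  ChainsAtMostTwo = ∀ x y z → Comparable x y → Comparable y z → Comparable x z →
                    (x ≈ y) ⊎ (y ≈ z) ⊎ (x ≈ z)

  record IsKleeneVarlet (g : X → X) : Set (c ⊔ ℓ₁ ⊔ ℓ₂) where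
    field
      g-cong : ∀ {x y} → x ≈ y → g x ≈ g y
      J1 : ∀ {x y} → x ≤ y → g y ≤ g x
      J2 : ∀ x → g (g x) ≈ x
      J3 : ∀ x → (x ≤ g x) ⊎ (g x ≤ x)
      J4 : ChainsAtMostTwo

  -- (X, ≤) is a union of disjoint chains of at most two elements:
  -- a partition of X into blocks (given by a block-index map), each block
  -- a chain with at most two elements, elements of different blocks
  -- incomparable.
  UnionOfDisjointTwoChains : (ℓ : Level) → Set (c ⊔ ℓ₁ ⊔ ℓ₂ ⊔ suc ℓ)
  UnionOfDisjointTwoChains ℓ =
    Σ (Set ℓ) λ I → Σ (X → I) λ block →
      (∀ x y → block x ≡ block y → Comparable x y) ×
      (∀ x y z → block x ≡ block y → block y ≡ block z →
         (x ≈ y) ⊎ (y ≈ z) ⊎ (x ≈ z)) ×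
      (∀ x y → Comparable x y → block x ≡ block y)
    where open import Relation.Binary.PropositionalEquality using (_≡_)

  UpwardClosed : {ℓ : Level} → Pred X ℓ → Set (c ⊔ ℓ₂ ⊔ ℓ)
  UpwardClosed A = ∀ {x y} → x ≤ y → x ∈ A → y ∈ A

  ↑ : X → Pred X ℓ₂
  ↑ x = λ y → x ≤ y

  _* : {ℓ : Level} → Pred X ℓ → Pred X (c ⊔ ℓ₂ ⊔ ℓ)
  (A *) x = Empty (↑ x ∩ A)

  image : {ℓ : Level} → (X → X) → Pred X ℓ → Pred X (c ⊔ ℓ₁ ⊔ ℓ)
  image g A y = ∃ λ a → a ∈ A × (g a ≈ y)

-- A* is by definition the complement of the down-set ↓A = { x | x ≤ a for
-- some a ∈ A }, so the theorem amounts to  A ∪ g[A] ≐ ↓A.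
--
-- For a ∈ A, (J3) compares a with g a: if
--     g a ≤ a then g a ∈ ↓A, and if a ≤ g a then g a ∈ A since A is upward
--     closed.
-- (⊇) The key order-theoretic fact: whenever x ≤ y, either y ≤ x or
--     x ≈ g y.  Since x ≤ y and x, g x are comparable, x, y and g x lie in a
--     single two-element chain, so x ≈ y, y ≈ g x or x ≈ g x.  The first two
--     cases are immediate; for a fixed point x ≈ g x, the chain
--     g y ≤ x ≤ y together with (J4) settles it.  Given x ≤ y ∈ A, the first
--     alternative puts x in A, the second puts x in g[A].
module Submission where

open import Defs
open import Level using (Level; _⊔_)
open import Data.Product using (∃; _×_; _,_)
open import Data.Sum using (_⊎_; inj₁; inj₂)
open import Relation.Binary.Bundles using (Poset)
open import Relation.Binary.PropositionalEquality using () renaming (sym to ≡-sym; trans to ≡-trans)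
open import Relation.Unary using (Pred; _∈_; _∪_; ∁; _⊆_; _≐_)
open import Relation.Unary.Properties using (≐-sym; ≐-trans)

∁-cong : {a ℓ₁ ℓ₂ : Level} {X : Set a} {A : Pred X ℓ₁} {B : Pred X ℓ₂} →
         A ≐ B → ∁ A ≐ ∁ B
∁-cong (A⊆B , B⊆A) = (λ x∉A x∈B → x∉A (B⊆A x∈B)) , (λ x∉B x∈A → x∉B (A⊆B x∈A))

module _ {c ℓ₁ ℓ₂ : Level} (P : Poset c ℓ₁ ℓ₂) where
  open Poset P renaming (Carrier to X)

  ↓ : {ℓA : Level} → Pred X ℓA → Pred X (c ⊔ ℓ₂ ⊔ ℓA)
  ↓ A x = ∃ λ y → x ≤ y × y ∈ A

  *-≐-∁↓ : {ℓA : Level} (A : Pred X ℓA) → _* P A ≐ ∁ (↓ A)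
  *-≐-∁↓ A = (λ empty (y , x≤y , yA) → empty y (x≤y , yA))
           , (λ notBelow y (x≤y , yA) → notBelow (y , x≤y , yA))

  module _ {g : X → X} (kv : IsKleeneVarlet P g) where
    open IsKleeneVarlet kv

    image-⊆-↓ : {ℓA : Level} (A : Pred X ℓA) → UpwardClosed P A →
                image P g A ⊆ ↓ A
    image-⊆-↓ A up (a , aA , ga≈x) with J3 a
    ... | inj₁ a≤ga = g a , reflexive (Eq.sym ga≈x) , up a≤ga aA
    ... | inj₂ ga≤a = a , trans (reflexive (Eq.sym ga≈x)) ga≤a , aA

    -- Below a fixed point of g, the dichotomy of the key fact already follows
    -- from (J4): the chain g y ≤ x ≤ y has at most two distinct elements.
    fixed-point-dichotomy : ∀ {x y} → x ≈ g x → x ≤ y → (y ≤ x) ⊎ (x ≈ g y)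
    fixed-point-dichotomy {x} {y} x≈gx x≤y
      with J4 (g y) x y (inj₁ gy≤x) (inj₁ x≤y) (inj₁ (trans gy≤x x≤y))
      where gy≤x = trans (J1 x≤y) (reflexive (Eq.sym x≈gx))
    ... | inj₁ gy≈x = inj₂ (Eq.sym gy≈x)
    ... | inj₂ (inj₁ x≈y) = inj₁ (reflexive (Eq.sym x≈y))
    ... | inj₂ (inj₂ gy≈y) =
      inj₁ (trans (reflexive (Eq.sym gy≈y)) (trans (J1 x≤y) (reflexive (Eq.sym x≈gx))))

    below-dichotomy : {ℓ : Level} → UnionOfDisjointTwoChains P ℓ →
                      ∀ {x y} → x ≤ y → (y ≤ x) ⊎ (x ≈ g y)
    below-dichotomy (_ , _ , _ , atMostTwo , comparable⇒sameBlock) {x} {y} x≤y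
      with atMostTwo x y (g x) x~y (≡-trans (≡-sym x~y) x~gx)
      where
      x~y  = comparable⇒sameBlock x y (inj₁ x≤y)
      x~gx = comparable⇒sameBlock x (g x) (J3 x)
    ... | inj₁ x≈y = inj₁ (reflexive (Eq.sym x≈y))
    ... | inj₂ (inj₁ y≈gx) = inj₂ (Eq.sym (Eq.trans (g-cong y≈gx) (J2 x)))
    ... | inj₂ (inj₂ x≈gx) = fixed-point-dichotomy x≈gx x≤y

    ↓-⊆-∪-image : {ℓ ℓA : Level} → UnionOfDisjointTwoChains P ℓ →
                  (A : Pred X ℓA) → UpwardClosed P A → ↓ A ⊆ A ∪ image P g A
    ↓-⊆-∪-image chains A up (y , x≤y , yA) with below-dichotomy chains x≤y
    ... | inj₁ y≤x  = inj₁ (up y≤x yA)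
    ... | inj₂ x≈gy = inj₂ (y , yA , Eq.sym x≈gy)

    ∪-image-≐-↓ : {ℓ ℓA : Level} → UnionOfDisjointTwoChains P ℓ →
                  (A : Pred X ℓA) → UpwardClosed P A → A ∪ image P g A ≐ ↓ A
    ∪-image-≐-↓ chains A up = ∪-⊆-↓ , ↓-⊆-∪-image chains A up
      where
      ∪-⊆-↓ : A ∪ image P g A ⊆ ↓ A
      ∪-⊆-↓ (inj₁ xA)  = _ , refl , xA
      ∪-⊆-↓ (inj₂ xgA) = image-⊆-↓ A up xgA

lemma5p2 : {c ℓ₁ ℓ₂ ℓ ℓA : Level} (P : Poset c ℓ₁ ℓ₂) (g : Poset.Carrier P → Poset.Carrier P) →
    IsKleeneVarlet P g → UnionOfDisjointTwoChains P ℓ →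
    (A : Pred (Poset.Carrier P) ℓA) → UpwardClosed P A →
    _* P A ≐ ∁ (A ∪ image P g A)
lemma5p2 P g kv chains A up =
  ≐-trans (*-≐-∁↓ P A) (∁-cong (≐-sym (∪-image-≐-↓ P kv chains A up)))
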